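{- Let $\ell\geq 2$ be an integer, let $G$ be a graph with girth exactly $2\ell$ and no even hole of length at least $2\ell+2$, and let $C$ be an even hole of $G$. Then every short jump $P$ over $C$ has length at least $\ell$, and $|P|=\ell$ if and only if $P$ is of type-e. Moreover, when $|P|=\ell$, both paths of $C$ having the same ends as $P$ have length $\ell$.
   Context: A hole is an induced cycle of length at least four; it is even if its length is even. For a hole $C$ and non-adjacent $s,t\in V(C)$, an $(s,t)$-jump over $C$ is an induced $(s,t)$-path $P$ none of whose internal vertices lies in $C$. Let $Q_1,Q_2$ be the two $(s,t)$-paths of $C$. $P$ is short if no internal vertex of $Q_1$ or $Q_2$ is adjacent to an internal vertex of $P$. For a short jump $P$ over an even hole $C$, the cycles $P\cup Q_1$ and $P\cup Q_2$ have the same parity; $P$ is of type-o if $P\cup Q_1$ is odd and of type-e if $P\cup Q_1$ is even. $|P|$ denotes the number of edges. -}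

module Defs where

open import Data.Nat using (ℕ; zero; suc; _+_; _∸_; _*_; _≤_; _<_; ∣_-_∣)
open import Data.Nat.Divisibility using (_∣_)
open import Data.Fin using (Fin; toℕ)
open import Data.Product using (Σ; _×_; _,_; ∃)
open import Data.Sum using (_⊎_)
open import Relation.Binary.PropositionalEquality using (_≡_; _≢_)
open import Relation.Nullary using (¬_)
open import Function.Definitions using (Injective)
open import Level using (0ℓ)

record Graph (n : ℕ) : Set₁ where
  field
    Adj     : Fin n → Fin n → Set
    symAdj  : ∀ {u v} → Adj u v → Adj v u
    irrAdj  : ∀ {u} → ¬ Adj u u
open Graph public

Even : ℕ → Set
Even m = 2 ∣ m

CycNbr : (k : ℕ) → Fin k → Fin k → Set
CycNbr k i j = (suc (toℕ i) ≡ toℕ j) ⊎ (suc (toℕ j) ≡ toℕ i)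
             ⊎ ((toℕ i ≡ 0) × (suc (toℕ j) ≡ k))
             ⊎ ((toℕ j ≡ 0) × (suc (toℕ i) ≡ k))

PathNbr : (m : ℕ) → Fin (suc m) → Fin (suc m) → Set
PathNbr m i j = (suc (toℕ i) ≡ toℕ j) ⊎ (suc (toℕ j) ≡ toℕ i)

module _ {n : ℕ} (G : Graph n) where

  IsCycle : (k : ℕ) → (Fin k → Fin n) → Set
  IsCycle k f = (3 ≤ k) × Injective _≡_ _≡_ f
              × (∀ i j → CycNbr k i j → Adj G (f i) (f j))

  IsInducedCycle : (k : ℕ) → (Fin k → Fin n) → Set
  IsInducedCycle k f = IsCycle k f × (∀ i j → Adj G (f i) (f j) → CycNbr k i j)

  IsHole : (k : ℕ) → (Fin k → Fin n) → Set
  IsHole k f = (4 ≤ k) × IsInducedCycle k f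

  IsEvenHole : (k : ℕ) → (Fin k → Fin n) → Set
  IsEvenHole k f = IsHole k f × Even k

  HasGirth : ℕ → Set
  HasGirth g = (Σ (Fin g → Fin n) λ f → IsCycle g f)
             × (∀ k (f : Fin k → Fin n) → IsCycle k f → g ≤ k)

  NoEvenHoleAtLeast : ℕ → Set
  NoEvenHoleAtLeast L = ∀ k (f : Fin k → Fin n) → IsEvenHole k f → ¬ (L ≤ k)

  IsInducedPath : (m : ℕ) → (Fin (suc m) → Fin n) → Set
  IsInducedPath m g = Injective _≡_ _≡_ g
                    × (∀ i j → PathNbr m i j → Adj G (g i) (g j))
                    × (∀ i j → Adj G (g i) (g j) → PathNbr m i j)

  Internal : (m : ℕ) → Fin (suc m) → Set
  Internal m p = (0 < toℕ p) × (toℕ p < m)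

  IsJump : (k : ℕ) → (Fin k → Fin n) → Fin k → Fin k
         → (m : ℕ) → (Fin (suc m) → Fin n) → Set
  IsJump k f a b m g =
      (a ≢ b) × ¬ Adj G (f a) (f b)
    × IsInducedPath m g
    × (g Data.Fin.zero ≡ f a) × (g (Data.Fin.fromℕ m) ≡ f b)
    × (∀ p → Internal m p → ∀ i → g p ≢ f i)

  -- short: no internal vertex of P is adjacent to an internal vertex of Q₁ or Q₂,
  -- i.e. to a vertex of C other than f a, f b
  IsShortJump : (k : ℕ) → (Fin k → Fin n) → Fin k → Fin k
              → (m : ℕ) → (Fin (suc m) → Fin n) → Set
  IsShortJump k f a b m g =
      IsJump k f a b m g
    × (∀ p → Internal m p → ∀ i → i ≢ a → i ≢ b → ¬ Adj G (g p) (f i))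

-- lengths of the two (f a, f b)-paths of a cycle of length k:
-- Q₁ runs through the positions strictly between a and b, Q₂ through the others
lenQ₁ : (k : ℕ) → Fin k → Fin k → ℕ
lenQ₁ k a b = ∣ toℕ a - toℕ b ∣

lenQ₂ : (k : ℕ) → Fin k → Fin k → ℕ
lenQ₂ k a b = k ∸ lenQ₁ k a b

-- type-e: the cycle P ∪ Q₁ (with |P| + |Q₁| edges) is even
TypeE : (k : ℕ) → Fin k → Fin k → (m : ℕ) → Set
TypeE k a b m = Even (m + lenQ₁ k a b)

{-# OPTIONS --safe #-}
module Submission where

-- Since P is short, P closes up with each of the two (a, b)-paths Q₁, Q₂ of C to a hole of
-- length |P| + |Qᵢ|.  The girth bounds every hole below by 2ℓ and the excluded even holes bound
-- every even hole above by 2ℓ; for C itself this gives |Q₁| + |Q₂| = |C| = 2ℓ.  Adding the two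
-- lower bounds gives |P| ≥ ℓ.  The two holes have the same parity, as |C| is even, so if P is of
-- type-e both have length exactly 2ℓ, which forces |P| = ℓ; conversely |P| = ℓ gives |Qᵢ| ≥ ℓ
-- for both i, hence |Q₁| = |Q₂| = ℓ and P ∪ Q₁ has even length 2ℓ.

open import Defs
open import Data.Nat using (ℕ; zero; suc; _+_; _∸_; _≤_; _<_; z≤n; s≤s; z<s; NonZero)
open import Data.Nat.Properties
open import Data.Nat.DivMod using (_%_; _mod_; %-distribˡ-+; m%n%n≡m%n; [m+n]%n≡m%n; m<n⇒m%n≡m; n%n≡0)
open import Data.Nat.Divisibility using (divides; ∣m+n∣m⇒∣n; ∣⇒≤)
open import Data.Fin using (Fin; zero; suc; toℕ; fromℕ; fromℕ<; inject₁; inject≤; opposite; splitAt)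
open import Data.Fin.Properties
  using (toℕ-injective; toℕ<n; toℕ-fromℕ; toℕ-fromℕ<; toℕ-inject₁; toℕ-inject≤; inject≤-injective;
         opposite-prop; opposite-involutive; toℕ-↑ˡ; toℕ-↑ʳ; splitAt⁻¹-↑ˡ; splitAt⁻¹-↑ʳ)
open import Data.Product using (Σ; _×_; _,_; proj₁; proj₂)
open import Data.Sum as Sum using (_⊎_; inj₁; inj₂; [_,_]′)
open import Data.Empty using (⊥-elim)
open import Function using (_∘_)
open import Function.Bundles using (_⇔_; mk⇔; Equivalence)
open import Function.Definitions using (Injective)
open import Relation.Nullary using (¬_)
open import Relation.Binary.PropositionalEquality
open import Algebra.Properties.CommutativeSemigroup +-commutativeSemigroup using (interchange)

open Equivalence using (to; from)
open ≡-Reasoning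

module _ (d : ℕ) .{{_ : NonZero d}} where

  [m+n%d]%d≡[m+n]%d : ∀ m n → (m + n % d) % d ≡ (m + n) % d
  [m+n%d]%d≡[m+n]%d m n = begin
    (m + n % d) % d          ≡⟨ %-distribˡ-+ m (n % d) d ⟩
    (m % d + n % d % d) % d  ≡⟨ cong (λ r → (m % d + r) % d) (m%n%n≡m%n n d) ⟩
    (m % d + n % d) % d      ≡⟨ %-distribˡ-+ m n d ⟨
    (m + n) % d              ∎

  +-cancelˡ-% : ∀ {b} x y → b ≤ d → (b + x) % d ≡ (b + y) % d → x % d ≡ y % d
  +-cancelˡ-% {b} x y b≤d eq = begin
    x % d                      ≡⟨ unshift x ⟨
    (d ∸ b + (b + x) % d) % d  ≡⟨ cong (λ r → (d ∸ b + r) % d) eq ⟩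
    (d ∸ b + (b + y) % d) % d  ≡⟨ unshift y ⟩
    y % d                      ∎
    where
    unshift : ∀ z → (d ∸ b + (b + z) % d) % d ≡ z % d
    unshift z = begin
      (d ∸ b + (b + z) % d) % d  ≡⟨ [m+n%d]%d≡[m+n]%d (d ∸ b) (b + z) ⟩
      (d ∸ b + (b + z)) % d      ≡⟨ cong (_% d) (+-assoc (d ∸ b) b z) ⟨
      (d ∸ b + b + z) % d        ≡⟨ cong (λ r → (r + z) % d) (m∸n+n≡m b≤d) ⟩
      (d + z) % d                ≡⟨ cong (_% d) (+-comm d z) ⟩
      (z + d) % d                ≡⟨ [m+n]%n≡m%n z d ⟩
      z % d                      ∎

suc-≡-resp : ∀ {a a′ b b′ : ℕ} → a ≡ a′ → b ≡ b′ → suc a ≡ b → suc a′ ≡ b′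
suc-≡-resp refl refl e = e

suc-+ˡ : ∀ m {a b} → suc a ≡ b → suc (m + a) ≡ m + b
suc-+ˡ m {a} e = trans (sym (+-suc m a)) (cong (m +_) e)

suc-+ˡ-cancel : ∀ m {a b} → suc (m + a) ≡ m + b → suc a ≡ b
suc-+ˡ-cancel m {a} e = +-cancelˡ-≡ m _ _ (trans (+-suc m a) e)

CycSucc : (k : ℕ) → Fin k → Fin k → Set
CycSucc k i j = (suc (toℕ i) ≡ toℕ j) ⊎ ((toℕ j ≡ 0) × (suc (toℕ i) ≡ k))

cycNbr⇔cycSucc : ∀ {k} {i j : Fin k} → CycNbr k i j ⇔ (CycSucc k i j ⊎ CycSucc k j i)
cycNbr⇔cycSucc = mk⇔ split join
  where
  split : ∀ {k} {i j : Fin k} → CycNbr k i j → CycSucc k i j ⊎ CycSucc k j i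
  split (inj₁ e)                 = inj₁ (inj₁ e)
  split (inj₂ (inj₁ e))          = inj₂ (inj₁ e)
  split (inj₂ (inj₂ (inj₁ w)))   = inj₂ (inj₂ w)
  split (inj₂ (inj₂ (inj₂ w)))   = inj₁ (inj₂ w)
  join : ∀ {k} {i j : Fin k} → CycSucc k i j ⊎ CycSucc k j i → CycNbr k i j
  join (inj₁ (inj₁ e)) = inj₁ e
  join (inj₂ (inj₁ e)) = inj₂ (inj₁ e)
  join (inj₂ (inj₂ w)) = inj₂ (inj₂ (inj₁ w))
  join (inj₁ (inj₂ w)) = inj₂ (inj₂ (inj₂ w))

module _ {k : ℕ} where

  cycSucc⇔% : {i j : Fin (suc k)} → CycSucc (suc k) i j ⇔ (suc (toℕ i) % suc k ≡ toℕ j)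
  cycSucc⇔% {i} {j} = mk⇔ ⇒% %⇒
    where
    ⇒% : CycSucc (suc k) i j → suc (toℕ i) % suc k ≡ toℕ j
    ⇒% (inj₁ e)        = trans (m<n⇒m%n≡m (subst (_< suc k) (sym e) (toℕ<n j))) e
    ⇒% (inj₂ (j0 , e)) = trans (cong (_% suc k) e) (trans (n%n≡0 (suc k)) (sym j0))
    %⇒ : suc (toℕ i) % suc k ≡ toℕ j → CycSucc (suc k) i j
    %⇒ e with m≤n⇒m<n∨m≡n (toℕ<n i)
    ... | inj₁ lt = inj₁ (trans (sym (m<n⇒m%n≡m lt)) e)
    ... | inj₂ eq = inj₂ (trans (sym e) (trans (cong (_% suc k) eq) (n%n≡0 (suc k))) , eq)

  rotate : Fin (suc k) → Fin (suc k) → Fin (suc k)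
  rotate b i = (toℕ b + toℕ i) mod suc k

  toℕ-rotate : ∀ b i → toℕ (rotate b i) ≡ (toℕ b + toℕ i) % suc k
  toℕ-rotate b i = toℕ-fromℕ< _

  rotate-zero : ∀ b → rotate b zero ≡ b
  rotate-zero b = toℕ-injective (begin
    toℕ (rotate b zero)  ≡⟨ toℕ-rotate b zero ⟩
    (toℕ b + 0) % suc k  ≡⟨ cong (_% suc k) (+-identityʳ (toℕ b)) ⟩
    toℕ b % suc k        ≡⟨ m<n⇒m%n≡m (toℕ<n b) ⟩
    toℕ b                ∎)

  rotate-injective : ∀ b → Injective _≡_ _≡_ (rotate b)
  rotate-injective b {i} {j} eq = toℕ-injective (begin
    toℕ i          ≡⟨ m<n⇒m%n≡m (toℕ<n i) ⟨
    toℕ i % suc k  ≡⟨ +-cancelˡ-% (suc k) (toℕ i) (toℕ j) (<⇒≤ (toℕ<n b))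
                        (trans (sym (toℕ-rotate b i)) (trans (cong toℕ eq) (toℕ-rotate b j))) ⟩
    toℕ j % suc k  ≡⟨ m<n⇒m%n≡m (toℕ<n j) ⟩
    toℕ j          ∎)

  suc-rotate : ∀ b i → suc (toℕ (rotate b i)) % suc k ≡ (toℕ b + suc (toℕ i)) % suc k
  suc-rotate b i = begin
    suc (toℕ (rotate b i)) % suc k        ≡⟨ cong (λ r → suc r % suc k) (toℕ-rotate b i) ⟩
    (1 + (toℕ b + toℕ i) % suc k) % suc k ≡⟨ [m+n%d]%d≡[m+n]%d (suc k) 1 (toℕ b + toℕ i) ⟩
    suc (toℕ b + toℕ i) % suc k           ≡⟨ cong (_% suc k) (+-suc (toℕ b) (toℕ i)) ⟨
    (toℕ b + suc (toℕ i)) % suc k         ∎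

  rotate-cycSucc : ∀ b {i j} → CycSucc (suc k) i j ⇔ CycSucc (suc k) (rotate b i) (rotate b j)
  rotate-cycSucc b {i} {j} = mk⇔
    (λ s → from cycSucc⇔% (begin
      suc (toℕ (rotate b i)) % suc k        ≡⟨ suc-rotate b i ⟩
      (toℕ b + suc (toℕ i)) % suc k         ≡⟨ [m+n%d]%d≡[m+n]%d (suc k) (toℕ b) (suc (toℕ i)) ⟨
      (toℕ b + suc (toℕ i) % suc k) % suc k ≡⟨ cong (λ r → (toℕ b + r) % suc k) (to cycSucc⇔% s) ⟩
      (toℕ b + toℕ j) % suc k               ≡⟨ toℕ-rotate b j ⟨
      toℕ (rotate b j)                      ∎))
    (λ s → from cycSucc⇔% (begin
      suc (toℕ i) % suc k  ≡⟨ +-cancelˡ-% (suc k) (suc (toℕ i)) (toℕ j) (<⇒≤ (toℕ<n b))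
                                (trans (sym (suc-rotate b i)) (trans (to cycSucc⇔% s) (toℕ-rotate b j))) ⟩
      toℕ j % suc k        ≡⟨ m<n⇒m%n≡m (toℕ<n j) ⟩
      toℕ j                ∎))

opposite-pathNbr : ∀ {m} {i j : Fin (suc m)} → PathNbr m i j → PathNbr m (opposite i) (opposite j)
opposite-pathNbr {m} {i} {j} = [ inj₂ ∘ step i j , inj₁ ∘ step j i ]′
  where
  step : ∀ i j → suc (toℕ i) ≡ toℕ j → suc (toℕ (opposite j)) ≡ toℕ (opposite i)
  step i j e = begin
    suc (toℕ (opposite j))  ≡⟨ cong suc (opposite-prop j) ⟩
    suc (m ∸ toℕ j)         ≡⟨ cong (λ t → suc (m ∸ t)) e ⟨
    suc (m ∸ suc (toℕ i))   ≡⟨ +-∸-assoc 1 (subst (_≤ m) (sym e) (≤-pred (toℕ<n j))) ⟨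
    m ∸ toℕ i               ≡⟨ opposite-prop i ⟨
    toℕ (opposite i)        ∎

opposite-fromℕ : ∀ m → opposite (fromℕ m) ≡ zero
opposite-fromℕ m = toℕ-injective (begin
  toℕ (opposite (fromℕ m))  ≡⟨ opposite-prop (fromℕ m) ⟩
  m ∸ toℕ (fromℕ m)         ≡⟨ cong (m ∸_) (toℕ-fromℕ m) ⟩
  m ∸ m                     ≡⟨ n∸n≡0 m ⟩
  0                         ∎)

arc : ∀ {k} {A : Set} → (Fin k → A) → (d : ℕ) → .(d < k) → Fin (suc d) → A
arc C d d<k j = C (inject≤ j d<k)

-- The closed walk P 0 … P (m - 1) Q 0 … Q (d - 1), which is a cycle when P m = Q 0 and Q d = P 0.
glue : ∀ {m d} {A : Set} → (Fin (suc m) → A) → (Fin (suc d) → A) → Fin (m + d) → A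
glue {m} P Q i = [ P ∘ inject₁ , Q ∘ inject₁ ]′ (splitAt m i)

data GluePosition {m d} {A : Set} (P : Fin (suc m) → A) (Q : Fin (suc d) → A) (i : Fin (m + d)) : Set where
  onP : (p : Fin (suc m)) → toℕ p < m → toℕ i ≡ toℕ p → glue P Q i ≡ P p → GluePosition P Q i
  onQ : (q : Fin (suc d)) → toℕ q < d → toℕ i ≡ m + toℕ q → glue P Q i ≡ Q q → GluePosition P Q i

gluePosition : ∀ {m d} {A : Set} (P : Fin (suc m) → A) (Q : Fin (suc d) → A) i → GluePosition P Q i
gluePosition {m} {d} P Q i with splitAt m i in eq
... | inj₁ x = onP (inject₁ x) (subst (_< m) (sym (toℕ-inject₁ x)) (toℕ<n x))
                 (trans (cong toℕ (sym (splitAt⁻¹-↑ˡ eq))) (trans (toℕ-↑ˡ x d) (sym (toℕ-inject₁ x))))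
                 (cong [ P ∘ inject₁ , Q ∘ inject₁ ]′ eq)
... | inj₂ y = onQ (inject₁ y) (subst (_< d) (sym (toℕ-inject₁ y)) (toℕ<n y))
                 (trans (cong toℕ (sym (splitAt⁻¹-↑ʳ eq)))
                        (trans (toℕ-↑ʳ m y) (cong (m +_) (sym (toℕ-inject₁ y)))))
                 (cong [ P ∘ inject₁ , Q ∘ inject₁ ]′ eq)

module _ {n : ℕ} (G : Graph n) where

  HasHole : ℕ → Set
  HasHole L = Σ (Fin L → Fin n) (IsHole G L)

  reindex-isInducedCycle : ∀ {k} {C : Fin k → Fin n} {σ : Fin k → Fin k} → Injective _≡_ _≡_ σ
                         → (∀ {i j} → CycSucc k i j ⇔ CycSucc k (σ i) (σ j))
                         → IsInducedCycle G k C → IsInducedCycle G k (C ∘ σ)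
  reindex-isInducedCycle {σ = σ} σ-inj σ-succ ((3≤k , C-inj , C-adj) , C-ind) =
    (3≤k , σ-inj ∘ C-inj , λ i j → C-adj (σ i) (σ j) ∘ σ-nbr) , λ i j → σ-nbr⁻¹ ∘ C-ind (σ i) (σ j)
    where
    σ-nbr : ∀ {i j} → CycNbr _ i j → CycNbr _ (σ i) (σ j)
    σ-nbr = from cycNbr⇔cycSucc ∘ Sum.map (to σ-succ) (to σ-succ) ∘ to cycNbr⇔cycSucc
    σ-nbr⁻¹ : ∀ {i j} → CycNbr _ (σ i) (σ j) → CycNbr _ i j
    σ-nbr⁻¹ = from cycNbr⇔cycSucc ∘ Sum.map (from σ-succ) (from σ-succ) ∘ to cycNbr⇔cycSucc

  reindex-isShortJump : ∀ {k} {C : Fin k → Fin n} {σ : Fin k → Fin k} {a b a′ b′ m P} → Injective _≡_ _≡_ σ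
                      → σ a′ ≡ a → σ b′ ≡ b
                      → IsShortJump G k C a b m P → IsShortJump G k (C ∘ σ) a′ b′ m P
  reindex-isShortJump {σ = σ} σ-inj refl refl ((a≢b , nonadj , P-path , P₀ , Pₘ , P-avoid) , short) =
    (a≢b ∘ cong σ , nonadj , P-path , P₀ , Pₘ , λ p p-int → P-avoid p p-int ∘ σ) ,
    λ p p-int i i≢a i≢b → short p p-int (σ i) (i≢a ∘ σ-inj) (i≢b ∘ σ-inj)

  opposite-internal : ∀ {m} {p : Fin (suc m)} → Internal G m p → Internal G m (opposite p)
  opposite-internal {m} {p} (0<p , p<m) =
    subst (0 <_) (sym (opposite-prop p)) (m<n⇒0<n∸m p<m) ,
    subst (_< m) (sym (opposite-prop p)) (∸-monoʳ-< 0<p (<⇒≤ p<m))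

  reverse-isInducedPath : ∀ {m P} → IsInducedPath G m P → IsInducedPath G m (P ∘ opposite)
  reverse-isInducedPath {m} (P-inj , P-adj , P-ind) =
    opposite-injective ∘ P-inj ,
    (λ i j → P-adj (opposite i) (opposite j) ∘ opposite-pathNbr) ,
    λ i j adj → subst₂ (PathNbr m) (opposite-involutive i) (opposite-involutive j)
                  (opposite-pathNbr (P-ind (opposite i) (opposite j) adj))
    where
    opposite-injective : ∀ {i j : Fin (suc m)} → opposite i ≡ opposite j → i ≡ j
    opposite-injective {i} {j} e = trans (sym (opposite-involutive i)) (trans (cong opposite e) (opposite-involutive j))

  reverse-isShortJump : ∀ {k C a b m P} → IsShortJump G k C a b m P → IsShortJump G k C b a m (P ∘ opposite)
  reverse-isShortJump {m = m} {P} ((a≢b , nonadj , P-path , P₀ , Pₘ , P-avoid) , short) =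
    (a≢b ∘ sym , nonadj ∘ symAdj G , reverse-isInducedPath P-path , Pₘ , trans (cong P (opposite-fromℕ m)) P₀ ,
     λ p → P-avoid (opposite p) ∘ opposite-internal) ,
    λ p p-int i i≢b i≢a → short (opposite p) (opposite-internal p-int) i i≢a i≢b

  arc-isInducedPath : ∀ {k d} {C : Fin k → Fin n} (sd<k : suc d < k)
                    → IsInducedCycle G k C → IsInducedPath G d (arc C d (<⇒≤ sd<k))
  arc-isInducedPath {k} {d} sd<k ((_ , C-inj , C-adj) , C-ind) =
    inject≤-injective _ _ _ _ ∘ C-inj ,
    (λ i j → C-adj (ι i) (ι j) ∘ [ inj₁ ∘ suc-≡-resp (sym (toℕ-ι i)) (sym (toℕ-ι j)) ,
                                   inj₂ ∘ inj₁ ∘ suc-≡-resp (sym (toℕ-ι j)) (sym (toℕ-ι i)) ]′) ,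
    λ i j → lower i j ∘ C-ind (ι i) (ι j)
    where
    ι : Fin (suc d) → Fin k
    ι j = inject≤ j (<⇒≤ sd<k)
    toℕ-ι : ∀ j → toℕ (ι j) ≡ toℕ j
    toℕ-ι j = toℕ-inject≤ j _
    no-wrap : ∀ j → suc (toℕ (ι j)) ≢ k
    no-wrap j e = <-irrefl e (≤-<-trans (s≤s (subst (_≤ d) (sym (toℕ-ι j)) (≤-pred (toℕ<n j)))) sd<k)
    lower : ∀ i j → CycNbr k (ι i) (ι j) → PathNbr d i j
    lower i j (inj₁ e)                     = inj₁ (suc-≡-resp (toℕ-ι i) (toℕ-ι j) e)
    lower i j (inj₂ (inj₁ e))              = inj₂ (suc-≡-resp (toℕ-ι j) (toℕ-ι i) e)
    lower i j (inj₂ (inj₂ (inj₁ (_ , e)))) = ⊥-elim (no-wrap j e)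
    lower i j (inj₂ (inj₂ (inj₂ (_ , e)))) = ⊥-elim (no-wrap i e)

  jump-length≥2 : ∀ {k C a b m P} → Injective _≡_ _≡_ C → IsJump G k C a b m P → 2 ≤ m
  jump-length≥2 {m = 0} C-inj (a≢b , _ , _ , P₀ , Pₘ , _) = ⊥-elim (a≢b (C-inj (trans (sym P₀) Pₘ)))
  jump-length≥2 {m = 1} _ (_ , nonadj , (_ , P-adj , _) , P₀ , Pₘ , _) =
    ⊥-elim (nonadj (subst₂ (Adj G) P₀ Pₘ (P-adj zero (suc zero) (inj₁ refl))))
  jump-length≥2 {m = suc (suc _)} _ _ = s≤s (s≤s z≤n)

  module _ {m d : ℕ} {P : Fin (suc m) → Fin n} {Q : Fin (suc d) → Fin n}
           (P-path : IsInducedPath G m P) (Q-path : IsInducedPath G d Q)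
           (P-end : P (fromℕ m) ≡ Q zero) (Q-end : Q (fromℕ d) ≡ P zero)
           (disjoint : ∀ p → Internal G m p → ∀ q → P p ≢ Q q)
           (no-edge : ∀ p → Internal G m p → ∀ q → Internal G d q → ¬ Adj G (P p) (Q q))
           (2≤m : 2 ≤ m) (2≤d : 2 ≤ d) where

    private
      P-inj : Injective _≡_ _≡_ P
      P-inj = proj₁ P-path
      P-adj : ∀ p p′ → PathNbr m p p′ → Adj G (P p) (P p′)
      P-adj = proj₁ (proj₂ P-path)
      P-ind : ∀ p p′ → Adj G (P p) (P p′) → PathNbr m p p′
      P-ind = proj₂ (proj₂ P-path)
      Q-inj : Injective _≡_ _≡_ Q
      Q-inj = proj₁ Q-path
      Q-adj : ∀ q q′ → PathNbr d q q′ → Adj G (Q q) (Q q′)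
      Q-adj = proj₁ (proj₂ Q-path)
      Q-ind : ∀ q q′ → Adj G (Q q) (Q q′) → PathNbr d q q′
      Q-ind = proj₂ (proj₂ Q-path)
      H : Fin (m + d) → Fin n
      H = glue P Q

    P≢Q : ∀ p → toℕ p < m → ∀ q → toℕ q < d → P p ≢ Q q
    P≢Q zero    _   q q<d e = <-irrefl (trans (cong toℕ (Q-inj (trans (sym e) (sym Q-end)))) (toℕ-fromℕ d)) q<d
    P≢Q (suc p) p<m q _   e = disjoint (suc p) (s≤s z≤n , p<m) q e

    glue-injective : Injective _≡_ _≡_ H
    glue-injective {i} {j} eq with gluePosition P Q i | gluePosition P Q j
    ... | onP p _ ip Hp | onP p′ _ jp Hp′ =
      toℕ-injective (trans ip (trans (cong toℕ (P-inj (trans (sym Hp) (trans eq Hp′)))) (sym jp)))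
    ... | onQ q _ iq Hq | onQ q′ _ jq Hq′ =
      toℕ-injective (trans iq (trans (cong (λ r → m + toℕ r) (Q-inj (trans (sym Hq) (trans eq Hq′)))) (sym jq)))
    ... | onP p p<m _ Hp | onQ q q<d _ Hq = ⊥-elim (P≢Q p p<m q q<d (trans (sym Hp) (trans eq Hq)))
    ... | onQ q q<d _ Hq | onP p p<m _ Hp = ⊥-elim (P≢Q p p<m q q<d (trans (sym Hp) (trans (sym eq) Hq)))

    glue-cycSucc-adj : ∀ i j → CycSucc (m + d) i j → Adj G (H i) (H j)
    glue-cycSucc-adj i j (inj₁ e) with gluePosition P Q i | gluePosition P Q j
    ... | onP p _ ip Hp | onP p′ _ jp Hp′ =
      subst₂ (Adj G) (sym Hp) (sym Hp′) (P-adj p p′ (inj₁ (suc-≡-resp ip jp e)))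
    ... | onP p _ ip Hp | onQ zero _ jq Hq =
      subst₂ (Adj G) (sym Hp) (trans P-end (sym Hq))
        (P-adj p (fromℕ m) (inj₁ (suc-≡-resp ip (trans jq (trans (+-identityʳ m) (sym (toℕ-fromℕ m)))) e)))
    ... | onP p p<m ip _ | onQ (suc q) _ jq _ =
      ⊥-elim (<⇒≱ p<m (≤-pred (subst (m <_) (sym (suc-≡-resp ip jq e)) (m<m+n m z<s))))
    ... | onQ q _ iq _ | onP p p<m jp _ =
      ⊥-elim (<⇒≱ p<m (subst (m ≤_) (suc-≡-resp iq jp e) (m≤n⇒m≤1+n (m≤m+n m (toℕ q)))))
    ... | onQ q _ iq Hq | onQ q′ _ jq Hq′ =
      subst₂ (Adj G) (sym Hq) (sym Hq′) (Q-adj q q′ (inj₁ (suc-+ˡ-cancel m (suc-≡-resp iq jq e))))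
    glue-cycSucc-adj i j (inj₂ (j≡0 , e)) with gluePosition P Q i | gluePosition P Q j
    ... | onP p p<m ip _ | _ =
      ⊥-elim (<-irrefl (subst (λ u → suc u ≡ m + d) ip e) (≤-<-trans p<m (m<m+n m (≤-trans (s≤s z≤n) 2≤d))))
    ... | onQ _ _ _ _ | onQ q′ _ jq _ =
      ⊥-elim (<⇒≢ (≤-trans (s≤s z≤n) 2≤m) (sym (m+n≡0⇒m≡0 m (trans (sym jq) j≡0))))
    ... | onQ _ _ _ _ | onP (suc p) _ jp _ = ⊥-elim (0≢1+n (trans (sym j≡0) jp))
    ... | onQ q _ iq Hq | onP zero _ _ Hp =
      subst₂ (Adj G) (sym Hq) (trans Q-end (sym Hp))
        (Q-adj q (fromℕ d)
          (inj₁ (trans (suc-+ˡ-cancel m (subst (λ u → suc u ≡ m + d) iq e)) (sym (toℕ-fromℕ d)))))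

    P-Q-adj⇒consecutive : ∀ p → toℕ p < m → ∀ q → toℕ q < d → Adj G (P p) (Q q)
            → (suc (toℕ p) ≡ m + toℕ q) ⊎ ((toℕ p ≡ 0) × (suc (m + toℕ q) ≡ m + d))
    P-Q-adj⇒consecutive zero _ q q<d adj with Q-ind (fromℕ d) q (subst (λ v → Adj G v (Q q)) (sym Q-end) adj)
    ... | inj₁ e = ⊥-elim (<⇒≱ q<d (subst (d ≤_) (trans (cong suc (sym (toℕ-fromℕ d))) e) (n≤1+n d)))
    ... | inj₂ e = inj₂ (refl , suc-+ˡ m (trans e (toℕ-fromℕ d)))
    P-Q-adj⇒consecutive (suc p) p<m zero _ adj with P-ind (suc p) (fromℕ m) (subst (Adj G (P (suc p))) (sym P-end) adj)
    ... | inj₁ e = inj₁ (trans e (trans (toℕ-fromℕ m) (sym (+-identityʳ m))))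
    ... | inj₂ e = ⊥-elim (<⇒≱ p<m (subst (m ≤_) (trans (cong suc (sym (toℕ-fromℕ m))) e) (n≤1+n m)))
    P-Q-adj⇒consecutive (suc p) p<m (suc q) q<d adj =
      ⊥-elim (no-edge (suc p) (s≤s z≤n , p<m) (suc q) (s≤s z≤n , q<d) adj)

    consecutive⇒cycSucc : ∀ {i j : Fin (m + d)} {a b} → toℕ i ≡ a → toℕ j ≡ b
                        → (suc a ≡ b) ⊎ (suc b ≡ a)
                        → CycSucc (m + d) i j ⊎ CycSucc (m + d) j i
    consecutive⇒cycSucc ia jb (inj₁ e) = inj₁ (inj₁ (suc-≡-resp (sym ia) (sym jb) e))
    consecutive⇒cycSucc ia jb (inj₂ e) = inj₂ (inj₁ (suc-≡-resp (sym jb) (sym ia) e))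

    glue-chordless : ∀ i j → Adj G (H i) (H j) → CycNbr (m + d) i j
    glue-chordless i j adj = from cycNbr⇔cycSucc (chord (gluePosition P Q i) (gluePosition P Q j))
      where
      across : ∀ {i j p q} → toℕ p < m → toℕ q < d → toℕ i ≡ toℕ p → toℕ j ≡ m + toℕ q
             → Adj G (P p) (Q q)
             → CycSucc (m + d) i j ⊎ CycSucc (m + d) j i
      across {p = p} {q} p<m q<d ip jq adj with P-Q-adj⇒consecutive p p<m q q<d adj
      ... | inj₁ e          = inj₁ (inj₁ (suc-≡-resp (sym ip) (sym jq) e))
      ... | inj₂ (p≡0 , e) = inj₂ (inj₂ (trans ip p≡0 , subst (λ u → suc u ≡ m + d) (sym jq) e))
      chord : GluePosition P Q i → GluePosition P Q j → CycSucc (m + d) i j ⊎ CycSucc (m + d) j i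
      chord (onP p _ ip Hp) (onP p′ _ jp Hp′) =
        consecutive⇒cycSucc ip jp (P-ind p p′ (subst₂ (Adj G) Hp Hp′ adj))
      chord (onQ q _ iq Hq) (onQ q′ _ jq Hq′) =
        consecutive⇒cycSucc iq jq (Sum.map (suc-+ˡ m) (suc-+ˡ m) (Q-ind q q′ (subst₂ (Adj G) Hq Hq′ adj)))
      chord (onP p p<m ip Hp) (onQ q q<d jq Hq) = across p<m q<d ip jq (subst₂ (Adj G) Hp Hq adj)
      chord (onQ q q<d iq Hq) (onP p p<m jp Hp) = Sum.swap (across p<m q<d jp iq (subst₂ (Adj G) Hp Hq (symAdj G adj)))

    glue-isHole : IsHole G (m + d) H
    glue-isHole =
      4≤m+d ,
      ((≤-trans (n≤1+n 3) 4≤m+d , glue-injective ,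
        λ i j → [ glue-cycSucc-adj i j , symAdj G ∘ glue-cycSucc-adj j i ]′ ∘ to cycNbr⇔cycSucc) ,
       glue-chordless)
      where
      4≤m+d : 4 ≤ m + d
      4≤m+d = +-mono-≤ 2≤m 2≤d

  jump-hole₀ : ∀ {k C a b m P} → IsInducedCycle G k C → IsShortJump G k C a b m P → toℕ b ≡ 0
             → HasHole (m + toℕ a)
  jump-hole₀ {k} {C} {a} {b} {m} {P} C-cycle@((_ , C-inj , C-adj) , _)
             J@((a≢b , nonadj , P-path , P₀ , Pₘ , P-avoid) , short) b≡0 =
    glue P Q ,
    glue-isHole P-path (arc-isInducedPath 1+d<k C-cycle) P-end Q-end
      (λ p p-int q → P-avoid p p-int (inject≤ q _)) no-edge (jump-length≥2 C-inj (proj₁ J)) 2≤d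
    where
    d : ℕ
    d = toℕ a
    ¬nbr : ¬ CycNbr k a b
    ¬nbr = nonadj ∘ C-adj a b
    2≤d : 2 ≤ d
    2≤d = ≤∧≢⇒< (n≢0⇒n>0 (λ e → a≢b (toℕ-injective (trans e (sym b≡0)))))
                (λ e → ¬nbr (inj₂ (inj₁ (trans (cong suc b≡0) e))))
    1+d<k : suc d < k
    1+d<k = ≤∧≢⇒< (toℕ<n a) (λ e → ¬nbr (inj₂ (inj₂ (inj₂ (b≡0 , e)))))
    Q : Fin (suc d) → Fin n
    Q = arc C d (<⇒≤ 1+d<k)
    P-end : P (fromℕ m) ≡ Q zero
    P-end = trans Pₘ (cong C (toℕ-injective (trans b≡0 (sym (toℕ-inject≤ zero _)))))
    Q-end : Q (fromℕ d) ≡ P zero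
    Q-end = trans (cong C (toℕ-injective (trans (toℕ-inject≤ (fromℕ d) _) (toℕ-fromℕ d)))) (sym P₀)
    no-edge : ∀ p → Internal G m p → ∀ q → Internal G d q → ¬ Adj G (P p) (Q q)
    no-edge p p-int q (0<q , q<d) = short p p-int (inject≤ q _)
      (λ e → <-irrefl (trans (sym (toℕ-inject≤ q _)) (cong toℕ e)) q<d)
      (λ e → <-irrefl (sym (trans (sym (toℕ-inject≤ q _)) (trans (cong toℕ e) b≡0))) 0<q)

  -- Rotating C so that b sits at position 0 makes the arc of C from b to a an initial segment.
  jump-hole : ∀ {k C a b m P} → IsInducedCycle G (suc k) C → IsShortJump G (suc k) C a b m P
            → (d : ℕ) (d<k : d < suc k) → (toℕ b + d) % suc k ≡ toℕ a → HasHole (m + d)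
  jump-hole {k} {a = a} {b} {m} C-cycle J d d<k b+d≡a =
    subst (λ r → HasHole (m + r)) (toℕ-fromℕ< d<k)
      (jump-hole₀ (reindex-isInducedCycle (rotate-injective b) (rotate-cycSucc b) C-cycle)
                  (reindex-isShortJump (rotate-injective b) rotate-d (rotate-zero b) J)
                  refl)
    where
    rotate-d : rotate b (fromℕ< d<k) ≡ a
    rotate-d = toℕ-injective (begin
      toℕ (rotate b (fromℕ< d<k))        ≡⟨ toℕ-rotate b _ ⟩
      (toℕ b + toℕ (fromℕ< d<k)) % suc k ≡⟨ cong (λ r → (toℕ b + r) % suc k) (toℕ-fromℕ< d<k) ⟩
      (toℕ b + d) % suc k                ≡⟨ b+d≡a ⟩
      toℕ a                              ∎)

  jump-holes-ordered : ∀ {k C a b m P} → IsInducedCycle G (suc k) C → IsShortJump G (suc k) C a b m P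
                     → toℕ b ≤ toℕ a → HasHole (m + lenQ₁ (suc k) a b) × HasHole (m + lenQ₂ (suc k) a b)
  jump-holes-ordered {k} {a = a} {b} {m} C-cycle J b≤a =
    subst (λ r → HasHole (m + r) × HasHole (m + (suc k ∸ r))) (sym (m≤n⇒∣n-m∣≡n∸m b≤a))
      (jump-hole C-cycle J q q<k b+q≡a ,
       jump-hole C-cycle (reverse-isShortJump J) (suc k ∸ q) (∸-monoʳ-< 0<q (<⇒≤ q<k)) a+[k∸q]≡b)
    where
    q : ℕ
    q = toℕ a ∸ toℕ b
    q<k : q < suc k
    q<k = ≤-<-trans (m∸n≤m (toℕ a) (toℕ b)) (toℕ<n a)
    0<q : 0 < q
    0<q = m<n⇒0<n∸m (≤∧≢⇒< b≤a (λ e → proj₁ (proj₁ J) (toℕ-injective (sym e))))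
    b+q≡a : (toℕ b + q) % suc k ≡ toℕ a
    b+q≡a = trans (cong (_% suc k) (m+[n∸m]≡n b≤a)) (m<n⇒m%n≡m (toℕ<n a))
    a+[k∸q]≡b : (toℕ a + (suc k ∸ q)) % suc k ≡ toℕ b
    a+[k∸q]≡b = begin
      (toℕ a + (suc k ∸ q)) % suc k      ≡⟨ cong (λ r → (r + (suc k ∸ q)) % suc k) (m+[n∸m]≡n b≤a) ⟨
      (toℕ b + q + (suc k ∸ q)) % suc k  ≡⟨ cong (_% suc k) (+-assoc (toℕ b) q (suc k ∸ q)) ⟩
      (toℕ b + (q + (suc k ∸ q))) % suc k ≡⟨ cong (λ r → (toℕ b + r) % suc k) (m+[n∸m]≡n (<⇒≤ q<k)) ⟩
      (toℕ b + suc k) % suc k            ≡⟨ [m+n]%n≡m%n (toℕ b) (suc k) ⟩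
      toℕ b % suc k                      ≡⟨ m<n⇒m%n≡m (toℕ<n b) ⟩
      toℕ b                              ∎

  jump-holes : ∀ {k C a b m P} → IsInducedCycle G (suc k) C → IsShortJump G (suc k) C a b m P
             → HasHole (m + lenQ₁ (suc k) a b) × HasHole (m + lenQ₂ (suc k) a b)
  jump-holes {k} {a = a} {b} {m} C-cycle J with ≤-total (toℕ b) (toℕ a)
  ... | inj₁ b≤a = jump-holes-ordered C-cycle J b≤a
  ... | inj₂ a≤b = subst (λ r → HasHole (m + r) × HasHole (m + (suc k ∸ r))) (∣-∣-comm (toℕ b) (toℕ a))
                     (jump-holes-ordered C-cycle (reverse-isShortJump J) a≤b)

even-double : ∀ n → Even (n + n)
even-double n = divides n (trans (cong (n +_) (sym (+-identityʳ n))) (*-comm 2 n))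

odd-suc-double : ∀ n → ¬ Even (suc (n + n))
odd-suc-double n ev with ∣⇒≤ (∣m+n∣m⇒∣n (subst Even (+-comm 1 (n + n)) ev) (even-double n))
... | s≤s ()

even≤1+n+n⇒≤n+n : ∀ {L} n → Even L → L ≤ suc (n + n) → L ≤ n + n
even≤1+n+n⇒≤n+n {L} n ev L≤ with m≤n⇒m<n∨m≡n L≤
... | inj₁ L<  = ≤-pred L<
... | inj₂ L≡ = ⊥-elim (odd-suc-double n (subst Even L≡ ev))

m+m≤n+n⇒m≤n : ∀ {m n} → m + m ≤ n + n → m ≤ n
m+m≤n+n⇒m≤n le = ≮⇒≥ (λ n<m → <⇒≱ (+-mono-< n<m n<m) le)

m+m≡n+n⇒m≡n : ∀ {m n} → m + m ≡ n + n → m ≡ n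
m+m≡n+n⇒m≡n eq = ≤-antisym (m+m≤n+n⇒m≤n (≤-reflexive eq)) (m+m≤n+n⇒m≤n (≤-reflexive (sym eq)))

m≤n∧m≤o∧n+o≡m+m⇒n≡m : ∀ {m n o} → m ≤ n → m ≤ o → n + o ≡ m + m → n ≡ m
m≤n∧m≤o∧n+o≡m+m⇒n≡m {m} {n} m≤n m≤o eq =
  ≤-antisym (+-cancelʳ-≤ m n m (≤-trans (+-monoʳ-≤ n m≤o) (≤-reflexive eq))) m≤n

HoleLengthBounds : ℕ → ℕ → Set
HoleLengthBounds ℓ L = (ℓ + ℓ ≤ L) × (Even L → L ≤ ℓ + ℓ)

hole-arithmetic : ∀ {ℓ m q₁ q₂} → q₁ + q₂ ≡ ℓ + ℓ
                → HoleLengthBounds ℓ (m + q₁) → HoleLengthBounds ℓ (m + q₂)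
                → (ℓ ≤ m) × ((m ≡ ℓ) ⇔ Even (m + q₁)) × (m ≡ ℓ → (q₁ ≡ ℓ) × (q₂ ≡ ℓ))
hole-arithmetic {ℓ} {m} {q₁} {q₂} q₁+q₂ (lo₁ , hi₁) (lo₂ , hi₂) =
  m+m≤n+n⇒m≤n (+-cancelʳ-≤ (ℓ + ℓ) (ℓ + ℓ) (m + m)
                 (≤-trans (+-mono-≤ lo₁ lo₂) (≤-reflexive sum))) ,
  mk⇔ (λ m≡ℓ → subst Even (sym (cong₂ _+_ m≡ℓ (proj₁ (sides m≡ℓ)))) (even-double ℓ)) even⇒m≡ℓ ,
  sides
  where
  sum : (m + q₁) + (m + q₂) ≡ (m + m) + (ℓ + ℓ)
  sum = trans (interchange m q₁ m q₂) (cong ((m + m) +_) q₁+q₂)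
  sides : m ≡ ℓ → (q₁ ≡ ℓ) × (q₂ ≡ ℓ)
  sides m≡ℓ = m≤n∧m≤o∧n+o≡m+m⇒n≡m ℓ≤q₁ ℓ≤q₂ q₁+q₂ ,
              m≤n∧m≤o∧n+o≡m+m⇒n≡m ℓ≤q₂ ℓ≤q₁ (trans (+-comm q₂ q₁) q₁+q₂)
    where
    ℓ≤q₁ : ℓ ≤ q₁
    ℓ≤q₁ = +-cancelˡ-≤ ℓ ℓ q₁ (subst (λ r → ℓ + ℓ ≤ r + q₁) m≡ℓ lo₁)
    ℓ≤q₂ : ℓ ≤ q₂
    ℓ≤q₂ = +-cancelˡ-≤ ℓ ℓ q₂ (subst (λ r → ℓ + ℓ ≤ r + q₂) m≡ℓ lo₂)
  even⇒m≡ℓ : Even (m + q₁) → m ≡ ℓ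
  even⇒m≡ℓ ev₁ = m+m≡n+n⇒m≡n (+-cancelʳ-≡ (ℓ + ℓ) (m + m) (ℓ + ℓ) (begin
    (m + m) + (ℓ + ℓ)      ≡⟨ sum ⟨
    (m + q₁) + (m + q₂)    ≡⟨ cong₂ _+_ (≤-antisym (hi₁ ev₁) lo₁) (≤-antisym (hi₂ ev₂) lo₂) ⟩
    (ℓ + ℓ) + (ℓ + ℓ)      ∎))
    where
    ev₂ : Even (m + q₂)
    ev₂ = ∣m+n∣m⇒∣n (subst Even (sym (trans sum (interchange m m ℓ ℓ))) (even-double (m + ℓ))) ev₁

hole-length-bounds : ∀ {n} (G : Graph n) ℓ → HasGirth G (ℓ + ℓ) → NoEvenHoleAtLeast G (ℓ + ℓ + 2)
                   → ∀ {L} → HasHole G L → HoleLengthBounds ℓ L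
hole-length-bounds G ℓ girth no-long-even-hole {L} (H , H-hole@(_ , H-cycle , _)) =
  proj₂ girth L H H-cycle ,
  λ ev → even≤1+n+n⇒≤n+n ℓ ev
           (≤-pred (subst (L <_) (+-comm (ℓ + ℓ) 2) (≰⇒> (no-long-even-hole L H (H-hole , ev)))))

lemma2p6 : (ℓ : ℕ) → 2 ≤ ℓ → (n : ℕ) → (G : Graph n)
    → HasGirth G (ℓ + ℓ)
    → NoEvenHoleAtLeast G (ℓ + ℓ + 2)
    → (k : ℕ) (C : Fin k → Fin n) → IsEvenHole G k C
    → (a b : Fin k) (m : ℕ) (P : Fin (suc m) → Fin n)
    → IsShortJump G k C a b m P
    → (ℓ ≤ m)
      × ((m ≡ ℓ) ⇔ TypeE k a b m)
      × (m ≡ ℓ → (lenQ₁ k a b ≡ ℓ) × (lenQ₂ k a b ≡ ℓ))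
lemma2p6 ℓ _ n G girth no-long-even-hole zero C ((() , _) , _) a b m P J
lemma2p6 ℓ _ n G girth no-long-even-hole (suc k) C (C-hole , C-even) a b m P J =
  hole-arithmetic (trans lenQ₁+lenQ₂ |C|≡ℓ+ℓ) (bounds (proj₁ holes)) (bounds (proj₂ holes))
  where
  bounds : ∀ {L} → HasHole G L → HoleLengthBounds ℓ L
  bounds = hole-length-bounds G ℓ girth no-long-even-hole
  holes : HasHole G (m + lenQ₁ (suc k) a b) × HasHole G (m + lenQ₂ (suc k) a b)
  holes = jump-holes G (proj₂ C-hole) J
  |C|≡ℓ+ℓ : suc k ≡ ℓ + ℓ
  |C|≡ℓ+ℓ = ≤-antisym (proj₂ (bounds (C , C-hole)) C-even) (proj₁ (bounds (C , C-hole)))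
  lenQ₁+lenQ₂ : lenQ₁ (suc k) a b + lenQ₂ (suc k) a b ≡ suc k
  lenQ₁+lenQ₂ = m+[n∸m]≡n
    (≤-trans (∣m-n∣≤m⊔n (toℕ a) (toℕ b)) (⊔-lub (<⇒≤ (toℕ<n a)) (<⇒≤ (toℕ<n b))))
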